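{- Fix an integer $l\ge 2$ and let $Z_U(M,N)$ denote the weighted number of paths from $(0,0)$ to $(M,N)$ in the lattice path model $\mathcal{L}_U$ described in the context. Let $k\ge 0$ be an integer and let $(M,N)$ be a point of the lattice with $M\ge 0$, $N\ge 0$, $M+N$ even and $lk-1\le M\le l(k+1)-2$. Then $$Z_U(M,N)=F^{(N)}_{M}+\sum_{j=1}^{\left\lfloor\frac{N-lk+1}{2l}+\frac{1}{2}\right\rfloor}F^{(N)}_{M-2lk-2jl}+\sum_{j=1}^{\left\lfloor\frac{N-lk+1}{2l}\right\rfloor}F^{(N)}_{M+2jl},$$ where $F^{(N)}_{m}=\binom{N}{\frac{N-m}{2}}-\binom{N}{\frac{N-m}{2}-1}$ and empty sums are $0$.
   Context: Lattice: $\mathcal{L}=\{(x,y)\in\mathbb{Z}^2: x+y\equiv 0 \pmod 2\}$. A lattice path model is given by a set of allowed steps $(x,y)\to(x',y+1)$ between lattice points, each with a positive weight. A path from $(0,0)$ to $(M,N)$ is a sequence $P_0=(0,0),P_1,\dots,P_N=(M,N)$ of lattice points with each $P_i\to P_{i+1}$ an allowed step; its weight is the product of the weights of its steps, and the weighted number of paths is the sum of the weights of all such paths ($0$ if there are none). Model $\mathcal{L}_U$ (depending on $l$): elementary steps are determined as follows. Left wall at $x=0$: from $(0,y)$ the only elementary step is $(0,y)\to(1,y+1)$, weight $1$. Filters of type 1 at $x=d$ for every $d=nl-1$, $n=1,2,3,\dots$: from $(d,y)$ the only elementary step is $(d,y)\to(d+1,y+1)$ with weight $1$; from $(d+1,y)$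 the only elementary steps are $(d+1,y)\to(d+2,y+1)$ with weight $1$ and $(d+1,y)\to(d,y+1)$ with weight $2$. From every other point $(x,y)$ the elementary steps are $(x,y)\to(x+1,y+1)$ and $(x,y)\to(x-1,y+1)$, each of weight $1$. In addition, for every integer $k\ge1$, $\mathcal{L}_U$ contains the long steps $(l(k+2)-2,\,lk-2+2m)\to(lk-1,\,lk-1+2m)$ for all integers $m\ge 0$, each of weight $1$. Binomial convention: $\binom{n}{x}=0$ unless $x$ is an integer with $0\le x\le n$. $\lfloor\cdot\rfloor$ is the integer part. -}

module Defs where

open import Data.Bool using (Bool; true; false; if_then_else_; _∧_; _∨_; not)
open import Data.Nat using (ℕ; zero; suc; _+_; _*_; _∸_; _/_; _≡ᵇ_; _≤ᵇ_)
open import Data.Nat.Divisibility using (_∣?_)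
open import Data.Nat.Combinatorics using (_C_)
open import Data.List using (List; upTo; map; foldr)
open import Data.Integer as ℤ using (ℤ; +_; -[1+_])
open import Relation.Nullary.Decidable using (does)

-- Points are (x , y) with x, y ∈ ℕ (paths start at (0,0) and the left
-- wall at x = 0 prevents x < 0).  A step goes from (x , y) to (x' , y+1).

elemW : ℕ → ℕ → ℕ → ℕ
elemW l zero x' = if x' ≡ᵇ 1 then 1 else 0
elemW l x@(suc _) x' =
  if does (l ∣? suc x) then                                 -- x = d = n l - 1, n ≥ 1
    (if x' ≡ᵇ suc x then 1 else 0)
  else if does (l ∣? x) then                                -- x = d + 1 = n l, n ≥ 1
    ((if x' ≡ᵇ suc x then 1 else 0) + (if suc x' ≡ᵇ x then 2 else 0))
  else
    ((if x' ≡ᵇ suc x then 1 else 0) + (if suc x' ≡ᵇ x then 1 else 0))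

-- Total weight of long steps (x , y) → (x' , y + 1):
-- long steps (l(k+2)-2 , lk-2+2m) → (lk-1 , lk-1+2m), k ≥ 1, m ≥ 0, weight 1.
-- We count the pairs (k , m); k ranges over 1 .. x'+1 and m over 0 .. y, which
-- contains every possible witness (lk - 1 = x' forces k ≤ x' + 1 for l ≥ 1,
-- and lk - 2 + 2m = y forces m ≤ y for lk ≥ 2).
longW : ℕ → ℕ → ℕ → ℕ → ℕ
longW l x y x' =
  foldr _+_ 0 (map (λ k → foldr _+_ 0 (map (λ m → indicator (suc k) m) (upTo (suc y))))
                   (upTo (suc x')))
  where
  indicator : ℕ → ℕ → ℕ
  indicator k m =
    if (x ≡ᵇ (l * (k + 2) ∸ 2)) ∧ (y ≡ᵇ (l * k ∸ 2 + 2 * m)) ∧ (x' ≡ᵇ (l * k ∸ 1))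
    then 1 else 0

stepW : ℕ → ℕ → ℕ → ℕ → ℕ
stepW l x y x' = elemW l x x' + longW l x y x'

-- zU l y x' = weighted number of paths from (0,0) to (x' , y).
-- Any step into (x' , y+1) starts at some x with x ≤ x' + 2l - 1
-- (elementary steps change x by ±1, long steps by -(2l-1)),
-- so summing over x < x' + 2l covers all last steps.
zU : ℕ → ℕ → ℕ → ℕ
zU l zero    x' = if x' ≡ᵇ 0 then 1 else 0
zU l (suc y) x' = foldr _+_ 0 (map (λ x → stepW l x y x' * zU l y x) (upTo (x' + 2 * l)))

ZU : ℕ → ℕ → ℕ → ℕ
ZU l M N = zU l N M

-- binomHalf N t = binom(N , t/2), which is 0 unless t/2 is an integer in [0,N].
binomHalf : ℕ → ℤ → ℤ
binomHalf N (+ t)    = if does (2 ∣? t) then + (N C (t / 2)) else + 0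
binomHalf N -[1+ _ ] = + 0

F : ℕ → ℤ → ℤ
F N m = binomHalf N (+ N ℤ.- m) ℤ.- binomHalf N (+ N ℤ.- m ℤ.- + 2)

sumFrom1 : ℕ → (ℕ → ℤ) → ℤ
sumFrom1 u f = foldr ℤ._+_ (+ 0) (map (λ j → f (suc j)) (upTo u))

-- natural-number floor division, with the (unused) convention a / 0 = 0
divℕ : ℕ → ℕ → ℕ
divℕ a zero    = 0
divℕ a (suc d) = a / suc d

module Submission where

open import Algebra.Bundles using (CommutativeMonoid)
open import Data.Bool using (Bool; true; false; if_then_else_; _∧_)
open import Data.Bool.Properties using (∧-zeroʳ; ∧-identityʳ)
open import Data.Empty using (⊥-elim)
open import Data.Integer as ℤ using (ℤ; +_; -[1+_])
open import Data.Integer.DivMod using (_%ℕ_; _/ℕ_; n%ℕd<d; a≡a%ℕn+[a/ℕn]*n)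
open import Data.Integer.Properties as ℤP using (pos-*)
open import Data.Integer.Tactic.RingSolver using (solve-∀)
open import Data.List using (foldr; map; applyUpTo)
open import Data.Nat as ℕ using (ℕ; zero; suc; _≤_; _<_; z≤n; s≤s; _≡ᵇ_)
open import Data.Nat.Combinatorics using (_C_; k>n⇒nCk≡0; nCk≡nC[n∸k]; nCk+nC[k+1]≡[n+1]C[k+1])
open import Data.Nat.DivMod using (m*n/n≡m; m≡m%n+[m/n]*n; m%n<n)
open import Data.Nat.Divisibility using (_∣_; _∣?_; divides; ∣m+n∣m⇒∣n; ∣⇒≤; ∣1⇒≡1)
open import Data.Nat.Properties as ℕP using ()
import Data.Nat.Tactic.RingSolver as ℕSolver
open import Data.Product using (_,_; ∃-syntax)
open import Data.Sum using (_⊎_; inj₁; inj₂)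
open import Function using (_∘_; id)
open import Relation.Nullary using (¬_; yes; no)
open import Relation.Nullary.Decidable using (does; dec-true; dec-false)
open import Relation.Binary.PropositionalEquality using (_≡_; _≢_; refl; sym; trans; cong; cong₂; subst; module ≡-Reasoning)

open import Defs

-- These numbers satisfy Pascal's rule
-- F (N+1) m = F N (m-1) + F N (m+1), change sign under the reflection m ↦ -m-2 and vanish
-- for m > N. For M in the strip k, i.e. lk - 1 ≤ M ≤ l(k+1) - 2, consider
--   W k M N = Σᵢ F N (M + 2li) + Σᵢ F N (M - 2l(k+1+i)).
-- Inside the strip W satisfies the transfer equation of the walk, and it vanishes on the
-- walls x = -1 (for k = 0) and x = l(k+1) - 1. At the filter d = l(k+1) - 1, the left end
-- of strip k+1, a telescoping argument gives
--   W (k+1) d (N+1) = W k (d-1) N + 2 W (k+1) (d+1) N + W (k+2) (l(k+3)-2) N,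
-- which is the transfer equation at d: weight 2 from d+1 and the long step from
-- l(k+3) - 2 (when that step is unavailable, the last term vanishes by parity or distance).
-- So Z_U = W by induction on N, and dropping the terms that vanish because they lie more
-- than N away leaves the stated finite sums.

module IndexedSums {c ℓ} (M : CommutativeMonoid c ℓ) where
  open CommutativeMonoid M renaming (Carrier to A; refl to ≈-refl; sym to ≈-sym; trans to ≈-trans)
  open import Algebra.Properties.CommutativeSemigroup commutativeSemigroup using (interchange)
  open import Relation.Binary.Reasoning.Setoid setoid

  sum : ℕ → (ℕ → A) → A
  sum zero    f = ε
  sum (suc n) f = f 0 ∙ sum n (f ∘ suc)

  sum-foldr : ∀ n (g : ℕ → A) (h : ℕ → ℕ) → foldr _∙_ ε (map g (applyUpTo h n)) ≈ sum n (g ∘ h)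
  sum-foldr zero    g h = ≈-refl
  sum-foldr (suc n) g h = ∙-congˡ (sum-foldr n g (h ∘ suc))

  sum-cong : ∀ n {f g : ℕ → A} → (∀ i → f i ≈ g i) → sum n f ≈ sum n g
  sum-cong zero    f≈g = ≈-refl
  sum-cong (suc n) f≈g = ∙-cong (f≈g 0) (sum-cong n (f≈g ∘ suc))

  sum-zero : ∀ n {f : ℕ → A} → (∀ i → f i ≈ ε) → sum n f ≈ ε
  sum-zero zero    f≈ε = ≈-refl
  sum-zero (suc n) f≈ε = ≈-trans (∙-cong (f≈ε 0) (sum-zero n (f≈ε ∘ suc))) (identityˡ ε)

  sum-distrib : ∀ n (f g : ℕ → A) → sum n (λ i → f i ∙ g i) ≈ sum n f ∙ sum n g
  sum-distrib zero    f g = ≈-sym (identityˡ ε)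
  sum-distrib (suc n) f g = begin
    (f 0 ∙ g 0) ∙ sum n (λ i → f (suc i) ∙ g (suc i)) ≈⟨ ∙-congˡ (sum-distrib n (f ∘ suc) (g ∘ suc)) ⟩
    (f 0 ∙ g 0) ∙ (sum n (f ∘ suc) ∙ sum n (g ∘ suc)) ≈⟨ interchange _ _ _ _ ⟩
    (f 0 ∙ sum n (f ∘ suc)) ∙ (g 0 ∙ sum n (g ∘ suc)) ∎

  sum-+ : ∀ m n (f : ℕ → A) → sum (m ℕ.+ n) f ≈ sum m f ∙ sum n (λ j → f (m ℕ.+ j))
  sum-+ zero    n f = ≈-sym (identityˡ _)
  sum-+ (suc m) n f = ≈-trans (∙-congˡ (sum-+ m n (f ∘ suc))) (≈-sym (assoc _ _ _))

  sum-single : ∀ n c {f : ℕ → A} → c < n → (∀ i → i ≢ c → f i ≈ ε) → sum n f ≈ f c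
  sum-single (suc n) zero    c<n f≈ε = ≈-trans (∙-congˡ (sum-zero n (λ i → f≈ε (suc i) λ ()))) (identityʳ _)
  sum-single (suc n) (suc c) (s≤s c<n) f≈ε = ≈-trans (∙-congʳ (f≈ε 0 λ ()))
    (≈-trans (identityˡ _) (sum-single n c c<n (λ i i≢c → f≈ε (suc i) (i≢c ∘ ℕP.suc-injective))))

  sum-truncate : ∀ m n (f : ℕ → A) → (∀ j → f (m ℕ.+ j) ≈ ε) → sum (m ℕ.+ n) f ≈ sum m f
  sum-truncate m n f tail≈ε = ≈-trans (sum-+ m n f) (≈-trans (∙-congˡ (sum-zero n tail≈ε)) (identityʳ _))

module ℕΣ = IndexedSums ℕP.+-0-commutativeMonoid
module ℤΣ = IndexedSums ℤP.+-0-commutativeMonoid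

even-or-odd : ∀ d → ∃[ m ] (d ≡ 2 ℕ.* m ⊎ d ≡ 2 ℕ.* m ℕ.+ 1)
even-or-odd zero = 0 , inj₁ refl
even-or-odd (suc d) with even-or-odd d
... | m , inj₁ refl = m , inj₂ (ℕP.+-comm 1 (2 ℕ.* m))
... | m , inj₂ refl = suc m , inj₁ (cong suc (trans (ℕP.+-comm (2 ℕ.* m) 1) (sym (ℕP.+-suc m (m ℕ.+ 0)))))

2∤2q+1 : ∀ q → ¬ (2 ∣ 2 ℕ.* q ℕ.+ 1)
2∤2q+1 q 2∣ with ∣⇒≤ (∣m+n∣m⇒∣n 2∣ (divides q (ℕP.*-comm 2 q)))
... | s≤s ()

m<n*[1+m/n] : ∀ m n .{{_ : ℕ.NonZero n}} → m < n ℕ.* suc (m ℕ./ n)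
m<n*[1+m/n] m n = begin-strict
  m                             ≡⟨ m≡m%n+[m/n]*n m n ⟩
  m ℕ.% n ℕ.+ (m ℕ./ n) ℕ.* n   <⟨ ℕP.+-monoˡ-< _ (m%n<n m n) ⟩
  n ℕ.+ (m ℕ./ n) ℕ.* n         ≡⟨ cong (ℕ._+_ n) (ℕP.*-comm (m ℕ./ n) n) ⟩
  n ℕ.+ n ℕ.* (m ℕ./ n)         ≡⟨ sym (ℕP.*-suc n (m ℕ./ n)) ⟩
  n ℕ.* suc (m ℕ./ n)           ∎
  where open ℕP.≤-Reasoning

m≤m∸n+n : ∀ m n → m ≤ (m ℕ.∸ n) ℕ.+ n
m≤m∸n+n m n = ℕP.≤-trans (ℕP.m≤n+m∸n m n) (ℕP.≤-reflexive (ℕP.+-comm n (m ℕ.∸ n)))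

module IntegerSums where
  open import Data.Integer using (_+_; _-_; -_)

  sum-neg : ∀ n (f : ℕ → ℤ) → ℤΣ.sum n (λ i → - f i) ≡ - ℤΣ.sum n f
  sum-neg zero    f = refl
  sum-neg (suc n) f = trans (cong (_+_ (- f 0)) (sum-neg n _)) (sym (ℤP.neg-distrib-+ (f 0) _))

  sum-telescope : ∀ n (h : ℕ → ℤ) → ℤΣ.sum n h - ℤΣ.sum n (λ i → h (suc i)) ≡ h 0 - h n
  sum-telescope zero    h = sym (ℤP.+-inverseʳ (h 0))
  sum-telescope (suc n) h =
    trans (regroup (h 0) (h 1) _ _)
          (trans (cong (_+_ (h 0 - h 1)) (sum-telescope n (λ i → h (suc i)))) (chain (h 0) (h 1) (h (suc n))))
    where
    regroup : ∀ a b s t → (a + s) - (b + t) ≡ (a - b) + (s - t)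
    regroup = solve-∀
    chain : ∀ a b c → (a - b) + (b - c) ≡ a - c
    chain = solve-∀

  sum-shift : ∀ n (h : ℕ → ℤ) → ℤΣ.sum n (λ i → h (suc i)) ≡ ℤΣ.sum n h - (h 0 - h n)
  sum-shift n h = trans (back (ℤΣ.sum n h) _) (cong (_-_ (ℤΣ.sum n h)) (sum-telescope n h))
    where
    back : ∀ s t → t ≡ s - (s - t)
    back = solve-∀

  sumFrom1-sum : ∀ u f → sumFrom1 u f ≡ ℤΣ.sum u (λ j → f (suc j))
  sumFrom1-sum u f = ℤΣ.sum-foldr u (λ j → f (suc j)) id

open IntegerSums

module BallotNumbers where
  open import Data.Integer using (_+_; _-_; _*_; -_)

  binomℤ : ℕ → ℤ → ℤ
  binomℤ N (+ a)    = + (N C a)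
  binomℤ N -[1+ _ ] = + 0

  binomℤ-pascal : ∀ N q → binomℤ (suc N) q ≡ binomℤ N q + binomℤ N (q - + 1)
  binomℤ-pascal N (+ zero)  = refl
  binomℤ-pascal N (+ suc a) = cong +_ (trans (sym (nCk+nC[k+1]≡[n+1]C[k+1] N a)) (ℕP.+-comm (N C a) _))
  binomℤ-pascal N -[1+ a ]  = refl

  binomℤ-sym : ∀ N r → binomℤ N (+ N - r) ≡ binomℤ N r
  binomℤ-sym N (+ a) with a ℕ.≤? N
  ... | yes a≤N = begin
    binomℤ N (+ N - + a)   ≡⟨ cong (binomℤ N) (trans (ℤP.m-n≡m⊖n N a) (ℤP.⊖-≥ a≤N)) ⟩
    + (N C (N ℕ.∸ a))      ≡⟨ cong +_ (sym (nCk≡nC[n∸k] a≤N)) ⟩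
    + (N C a)              ∎
    where open ≡-Reasoning
  ... | no a≰N = begin
    binomℤ N (+ N - + a)          ≡⟨ cong (binomℤ N) (trans (ℤP.m-n≡m⊖n N a) (ℤP.⊖-< N<a)) ⟩
    binomℤ N (- + (a ℕ.∸ N))      ≡⟨ binomℤ-neg (ℕP.m<n⇒0<n∸m N<a) ⟩
    + 0                           ≡⟨ cong +_ (sym (k>n⇒nCk≡0 N<a)) ⟩
    + (N C a)                     ∎
    where
    open ≡-Reasoning
    N<a : N < a
    N<a = ℕP.≰⇒> a≰N
    binomℤ-neg : ∀ {t} → 0 < t → binomℤ N (- + t) ≡ + 0
    binomℤ-neg {suc t} _ = refl
  binomℤ-sym N -[1+ a ] = cong +_ (k>n⇒nCk≡0 (ℕP.m<m+n N (s≤s z≤n)))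

  binomHalf-even : ∀ N q → binomHalf N (+ 2 * q) ≡ binomℤ N q
  binomHalf-even N (+ a) rewrite sym (pos-* 2 a) | ℕP.*-comm 2 a
                               | dec-true (2 ∣? (a ℕ.* 2)) (divides a refl)
    = cong (λ b → + (N C b)) (m*n/n≡m a 2)
  binomHalf-even N -[1+ a ] = refl

  binomHalf-odd : ∀ N q → binomHalf N (+ 2 * q + + 1) ≡ + 0
  binomHalf-odd N (+ a) rewrite sym (pos-* 2 a) | dec-false (2 ∣? (2 ℕ.* a ℕ.+ 1)) (2∤2q+1 a) = refl
  binomHalf-odd N -[1+ a ] =
    cong (binomHalf N) (trans (negative (+ a)) (cong (λ z → - (+ 1 + z)) (sym (pos-* 2 a))))
    where
    negative : ∀ x → + 2 * (- (+ 1 + x)) + + 1 ≡ - (+ 1 + + 2 * x)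
    negative = solve-∀

  even-offset : ∀ n m q → n - m ≡ + 0 + q * + 2 → n - + 2 * q ≡ m
  even-offset n m q eq = trans (cong (_-_ n) (trans (double q) (sym eq))) (cancel n m)
    where
    double : ∀ q → + 2 * q ≡ + 0 + q * + 2
    double = solve-∀
    cancel : ∀ n m → n - (n - m) ≡ m
    cancel = solve-∀

  odd-offset : ∀ n m q → n - m ≡ + 1 + q * + 2 → n - + 2 * q - + 1 ≡ m
  odd-offset n m q eq = trans (regroup n q) (trans (cong (_-_ n) (sym eq)) (cancel n m))
    where
    regroup : ∀ n q → n - + 2 * q - + 1 ≡ n - (+ 1 + q * + 2)
    regroup = solve-∀
    cancel : ∀ n m → n - (n - m) ≡ m
    cancel = solve-∀

  data Offset (N : ℕ) : ℤ → Set where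
    even : ∀ q → Offset N (+ N - + 2 * q)
    odd  : ∀ q → Offset N (+ N - + 2 * q - + 1)

  offset : ∀ N m → Offset N m
  offset N m with (+ N - m) %ℕ 2 | n%ℕd<d (+ N - m) 2 | a≡a%ℕn+[a/ℕn]*n (+ N - m) 2
  ... | 0           | _            | eq = subst (Offset N) (even-offset (+ N) m q eq) (even q)
    where
    q : ℤ
    q = (+ N - m) /ℕ 2
  ... | 1           | _            | eq = subst (Offset N) (odd-offset (+ N) m q eq) (odd q)
    where
    q : ℤ
    q = (+ N - m) /ℕ 2
  ... | suc (suc _) | s≤s (s≤s ()) | _

  F-even : ∀ N q → F N (+ N - + 2 * q) ≡ binomℤ N q - binomℤ N (q - + 1)
  F-even N q = cong₂ _-_ (trans (cong (binomHalf N) (top (+ N) q)) (binomHalf-even N q))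
                         (trans (cong (binomHalf N) (below (+ N) q)) (binomHalf-even N (q - + 1)))
    where
    top : ∀ n q → n - (n - + 2 * q) ≡ + 2 * q
    top = solve-∀
    below : ∀ n q → n - (n - + 2 * q) - + 2 ≡ + 2 * (q - + 1)
    below = solve-∀

  F-odd : ∀ N q → F N (+ N - + 2 * q - + 1) ≡ + 0
  F-odd N q = cong₂ _-_ (trans (cong (binomHalf N) (top (+ N) q)) (binomHalf-odd N q))
                        (trans (cong (binomHalf N) (below (+ N) q)) (binomHalf-odd N (q - + 1)))
    where
    top : ∀ n q → n - (n - + 2 * q - + 1) ≡ + 2 * q + + 1
    top = solve-∀
    below : ∀ n q → n - (n - + 2 * q - + 1) - + 2 ≡ + 2 * (q - + 1) + + 1
    below = solve-∀

  F-pascal : ∀ N m → F (suc N) m ≡ F N (m - + 1) + F N (m + + 1)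
  F-pascal N m with offset N m
  ... | even q = begin
    F (suc N) (+ N - + 2 * q)                           ≡⟨ cong (F (suc N)) (shift (+ N) q) ⟩
    F (suc N) (+ suc N - + 2 * q - + 1)                 ≡⟨ F-odd (suc N) q ⟩
    + 0                                                 ≡⟨ sym (cong₂ _+_ (F-odd N q) (trans (cong (F N) (up (+ N) q)) (F-odd N (q - + 1)))) ⟩
    F N (+ N - + 2 * q - + 1) + F N (+ N - + 2 * q + + 1) ∎
    where
    open ≡-Reasoning
    shift : ∀ n q → n - + 2 * q ≡ (+ 1 + n) - + 2 * q - + 1
    shift = solve-∀
    up : ∀ n q → n - + 2 * q + + 1 ≡ n - + 2 * (q - + 1) - + 1
    up = solve-∀
  ... | odd q = begin
    F (suc N) (+ N - + 2 * q - + 1)                     ≡⟨ cong (F (suc N)) (shift (+ N) q) ⟩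
    F (suc N) (+ suc N - + 2 * (q + + 1))               ≡⟨ F-even (suc N) (q + + 1) ⟩
    B₁ (q + + 1) - B₁ (q + + 1 - + 1)                   ≡⟨ cong (λ r → B₁ (q + + 1) - B₁ r) (q+1-1 q) ⟩
    B₁ (q + + 1) - B₁ q                                 ≡⟨ cong₂ _-_ (binomℤ-pascal N (q + + 1)) (binomℤ-pascal N q) ⟩
    (B (q + + 1) + B (q + + 1 - + 1)) - (B q + B (q - + 1))
                                                        ≡⟨ cong (λ r → (B (q + + 1) + B r) - (B q + B (q - + 1))) (q+1-1 q) ⟩
    (B (q + + 1) + B q) - (B q + B (q - + 1))           ≡⟨ regroup (B (q + + 1)) (B q) (B (q - + 1)) ⟩
    (B (q + + 1) - B q) + (B q - B (q - + 1))           ≡⟨ cong (λ r → (B (q + + 1) - B r) + (B q - B (q - + 1))) (sym (q+1-1 q)) ⟩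
    (B (q + + 1) - B (q + + 1 - + 1)) + (B q - B (q - + 1))
                                                        ≡⟨ sym (cong₂ _+_ (trans (cong (F N) (down (+ N) q)) (F-even N (q + + 1)))
                                                                          (trans (cong (F N) (up (+ N) q)) (F-even N q))) ⟩
    F N (+ N - + 2 * q - + 1 - + 1) + F N (+ N - + 2 * q - + 1 + + 1) ∎
    where
    open ≡-Reasoning
    B B₁ : ℤ → ℤ
    B = binomℤ N
    B₁ = binomℤ (suc N)
    shift : ∀ n q → n - + 2 * q - + 1 ≡ (+ 1 + n) - + 2 * (q + + 1)
    shift = solve-∀
    down : ∀ n q → n - + 2 * q - + 1 - + 1 ≡ n - + 2 * (q + + 1)
    down = solve-∀
    up : ∀ n q → n - + 2 * q - + 1 + + 1 ≡ n - + 2 * q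
    up = solve-∀
    q+1-1 : ∀ q → q + + 1 - + 1 ≡ q
    q+1-1 = solve-∀
    regroup : ∀ a b c → (a + b) - (b + c) ≡ (a - b) + (b - c)
    regroup = solve-∀

  F-reflect : ∀ N m → F N (- m - + 2) ≡ - F N m
  F-reflect N m with offset N m
  ... | even q = begin
    F N (- (+ N - + 2 * q) - + 2)                            ≡⟨ cong (F N) (mirror (+ N) q) ⟩
    F N (+ N - + 2 * (+ N - (q - + 1)))                      ≡⟨ F-even N (+ N - (q - + 1)) ⟩
    binomℤ N (+ N - (q - + 1)) - binomℤ N (+ N - (q - + 1) - + 1)
                                                             ≡⟨ cong (λ r → binomℤ N (+ N - (q - + 1)) - binomℤ N r) (shift (+ N) q) ⟩
    binomℤ N (+ N - (q - + 1)) - binomℤ N (+ N - q)          ≡⟨ cong₂ _-_ (binomℤ-sym N (q - + 1)) (binomℤ-sym N q) ⟩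
    binomℤ N (q - + 1) - binomℤ N q                          ≡⟨ swap (binomℤ N q) (binomℤ N (q - + 1)) ⟩
    - (binomℤ N q - binomℤ N (q - + 1))                      ≡⟨ cong -_ (sym (F-even N q)) ⟩
    - F N (+ N - + 2 * q)                                    ∎
    where
    open ≡-Reasoning
    mirror : ∀ n q → - (n - + 2 * q) - + 2 ≡ n - + 2 * (n - (q - + 1))
    mirror = solve-∀
    shift : ∀ n q → n - (q - + 1) - + 1 ≡ n - q
    shift = solve-∀
    swap : ∀ a b → b - a ≡ - (a - b)
    swap = solve-∀
  ... | odd q = trans (cong (F N) (mirror (+ N) q)) (trans (F-odd N (+ N - q)) (sym (cong -_ (F-odd N q))))
    where
    mirror : ∀ n q → - (n - + 2 * q - + 1) - + 2 ≡ n - + 2 * (n - q) - + 1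
    mirror = solve-∀

  F-beyond : ∀ N t → N < t → F N (+ t) ≡ + 0
  F-beyond N t N<t with ℕP.m≤n⇒∃[o]m+o≡n N<t
  ... | o , refl = cong₂ _-_ (cong (binomHalf N) (past (+ N) (+ o))) (cong (binomHalf N) (further (+ N) (+ o)))
    where
    past : ∀ n o → n - (+ 1 + n + o) ≡ - (+ 1 + o)
    past = solve-∀
    further : ∀ n o → n - (+ 1 + n + o) - + 2 ≡ - (+ 3 + o)
    further = solve-∀

  F-beyond-reflected : ∀ N t → N < t → F N (- + t - + 2) ≡ + 0
  F-beyond-reflected N t N<t = trans (F-reflect N (+ t)) (cong -_ (F-beyond N t N<t))

  F-at-minus-1 : ∀ N → F N (- + 1) ≡ + 0
  F-at-minus-1 N = self-negation-is-zero (F-reflect N (- + 1))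
    where
    self-negation-is-zero : ∀ {x} → x ≡ - x → x ≡ + 0
    self-negation-is-zero {x = + zero} _  = refl
    self-negation-is-zero {x = + suc n} ()
    self-negation-is-zero {x = -[1+ n ]} ()

open BallotNumbers

module ImageSums (l : ℕ) (l≥2 : 2 ≤ l) where
  open import Data.Integer using (_+_; _-_; _*_; -_)
  open import Algebra.Properties.CommutativeSemigroup ℤP.+-commutativeSemigroup using (interchange)

  2l : ℤ
  2l = + 2 * + l

  2l*-pos : ∀ j → 2l * + j ≡ + (2 ℕ.* l ℕ.* j)
  2l*-pos j = sym (trans (pos-* (2 ℕ.* l) j) (cong (_* + j) (pos-* 2 l)))

  2n≤2ln : ∀ n → 2 ℕ.* n ≤ 2 ℕ.* l ℕ.* n
  2n≤2ln n = ℕP.*-monoˡ-≤ n (ℕP.*-monoʳ-≤ 2 (ℕP.≤-trans (s≤s z≤n) l≥2))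

  n≤2ln : ∀ n → n ≤ 2 ℕ.* l ℕ.* n
  n≤2ln n = ℕP.≤-trans (ℕP.m≤m+n n (n ℕ.+ 0)) (2n≤2ln n)

  -- n shifts m + 2li and, with the opposite sign (see F-reflect), their mirror images in
  -- the wall x = l(k+1) - 1.
  imageSum : ℕ → ℕ → ℤ → ℕ → ℤ
  imageSum n k m N = ℤΣ.sum n (λ i → F N (m + 2l * + i)) + ℤΣ.sum n (λ i → F N (m - 2l * (+ k + + 1 + + i)))

  F-right-image-vanishes : ∀ N a j → N < a ℕ.+ 2 ℕ.* l ℕ.* j → F N (+ a + 2l * + j) ≡ + 0
  F-right-image-vanishes N a j lt = trans (cong (λ z → F N (+ a + z)) (2l*-pos j)) (F-beyond N _ lt)

  F-left-image-vanishes : ∀ N a j → a ℕ.+ N ℕ.+ 2 < 2 ℕ.* l ℕ.* j → F N (+ a - 2l * + j) ≡ + 0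
  F-left-image-vanishes N a j lt with ℕP.m≤n⇒∃[o]m+o≡n lt
  ... | o , eq = begin
    F N (+ a - 2l * + j)                 ≡⟨ cong (λ z → F N (+ a - z)) (trans (2l*-pos j) (cong +_ (sym eq))) ⟩
    F N (+ a - + (suc (a ℕ.+ N ℕ.+ 2) ℕ.+ o)) ≡⟨ cong (F N) (reflected (+ a) (+ N) (+ o)) ⟩
    F N (- + (suc N ℕ.+ o) - + 2)        ≡⟨ F-beyond-reflected N (suc N ℕ.+ o) (s≤s (ℕP.m≤m+n N o)) ⟩
    + 0                                  ∎
    where
    open ≡-Reasoning
    reflected : ∀ a n o → a - (+ 1 + a + n + + 2 + o) ≡ - (+ 1 + n + o) - + 2
    reflected = solve-∀

  F-minus-1-image-vanishes : ∀ N j → suc N < 2 ℕ.* l ℕ.* j → F N (- + 1 + 2l * + j) ≡ + 0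
  F-minus-1-image-vanishes N j lt with ℕP.m≤n⇒∃[o]m+o≡n lt
  ... | o , eq = begin
    F N (- + 1 + 2l * + j)               ≡⟨ cong (λ z → F N (- + 1 + z)) (trans (2l*-pos j) (cong +_ (sym eq))) ⟩
    F N (- + 1 + + (suc (suc N) ℕ.+ o))  ≡⟨ cong (F N) (shift (+ N) (+ o)) ⟩
    F N (+ (suc N ℕ.+ o))                ≡⟨ F-beyond N (suc N ℕ.+ o) (s≤s (ℕP.m≤m+n N o)) ⟩
    + 0                                  ∎
    where
    open ≡-Reasoning
    shift : ∀ n o → - + 1 + (+ 1 + (+ 1 + n) + o) ≡ + 1 + n + o
    shift = solve-∀

  imageSum-pascal : ∀ n k m N → imageSum n k m (suc N) ≡ imageSum n k (m - + 1) N + imageSum n k (m + + 1) N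
  imageSum-pascal n k m N =
    trans (cong₂ _+_ (sum-pascal right) (sum-pascal left))
          (interchange (shifted (- + 1) right) (shifted (+ 1) right) (shifted (- + 1) left) (shifted (+ 1) left))
    where
    right left : ℕ → ℤ
    right i = 2l * + i
    left  i = - (2l * (+ k + + 1 + + i))
    shifted : ℤ → (ℕ → ℤ) → ℤ
    shifted s c = ℤΣ.sum n (λ i → F N ((m + s) + c i))
    sum-pascal : ∀ c → ℤΣ.sum n (λ i → F (suc N) (m + c i)) ≡ shifted (- + 1) c + shifted (+ 1) c
    sum-pascal c = trans (ℤΣ.sum-cong n (λ i → trans (F-pascal N (m + c i))
                                                      (cong₂ _+_ (cong (F N) (sub m (c i))) (cong (F N) (add m (c i))))))
                         (ℤΣ.sum-distrib n _ _)
      where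
      sub : ∀ m c → m + c - + 1 ≡ (m - + 1) + c
      sub = solve-∀
      add : ∀ m c → m + c + + 1 ≡ (m + + 1) + c
      add = solve-∀

  imageSum-right-wall : ∀ n k N → imageSum n k (+ l * (+ k + + 1) - + 1) N ≡ + 0
  imageSum-right-wall n k N = begin
    ℤΣ.sum n right + ℤΣ.sum n (λ i → F N (w - 2l * (+ k + + 1 + + i)))
      ≡⟨ cong (_+_ (ℤΣ.sum n right)) (ℤΣ.sum-cong n (λ i → trans (cong (F N) (mirror (+ l) (+ k) (+ i))) (F-reflect N (w + 2l * + i)))) ⟩
    ℤΣ.sum n right + ℤΣ.sum n (λ i → - right i)
      ≡⟨ cong (_+_ (ℤΣ.sum n right)) (sum-neg n right) ⟩
    ℤΣ.sum n right - ℤΣ.sum n right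
      ≡⟨ ℤP.+-inverseʳ (ℤΣ.sum n right) ⟩
    + 0 ∎
    where
    open ≡-Reasoning
    w : ℤ
    w = + l * (+ k + + 1) - + 1
    right : ℕ → ℤ
    right i = F N (w + 2l * + i)
    mirror : ∀ l k i → (l * (k + + 1) - + 1) - + 2 * l * (k + + 1 + i) ≡ - ((l * (k + + 1) - + 1) + + 2 * l * i) - + 2
    mirror = solve-∀

  imageSum-left-wall : ∀ n N → N < n → imageSum n 0 (- + 1) N ≡ + 0
  imageSum-left-wall n N N<n = begin
    ℤΣ.sum n h + ℤΣ.sum n (λ i → F N (- + 1 - 2l * (+ 0 + + 1 + + i)))
      ≡⟨ cong (_+_ (ℤΣ.sum n h)) (ℤΣ.sum-cong n (λ i → trans (cong (F N) (mirror (+ l) (+ i))) (F-reflect N (- + 1 + 2l * + suc i)))) ⟩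
    ℤΣ.sum n h + ℤΣ.sum n (λ i → - h (suc i))
      ≡⟨ cong (_+_ (ℤΣ.sum n h)) (sum-neg n (λ i → h (suc i))) ⟩
    ℤΣ.sum n h - ℤΣ.sum n (λ i → h (suc i))
      ≡⟨ sum-telescope n h ⟩
    h 0 - h n
      ≡⟨ cong₂ _-_ (trans (cong (F N) (origin 2l)) (F-at-minus-1 N)) (F-minus-1-image-vanishes N n far) ⟩
    + 0 ∎
    where
    open ≡-Reasoning
    h : ℕ → ℤ
    h i = F N (- + 1 + 2l * + i)
    mirror : ∀ l i → - + 1 - + 2 * l * (+ 0 + + 1 + i) ≡ - (- + 1 + + 2 * l * (+ 1 + i)) - + 2
    mirror = solve-∀
    origin : ∀ x → - + 1 + x * + 0 ≡ - + 1
    origin = solve-∀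
    far : suc N < 2 ℕ.* l ℕ.* n
    far = ℕP.≤-trans (s≤s (ℕP.m≤n+m (suc N) N))
                     (ℕP.≤-trans (ℕP.+-mono-≤ N<n (ℕP.≤-trans N<n (ℕP.≤-reflexive (sym (ℕP.+-identityʳ n))))) (2n≤2ln n))

  imageSum-odd : ∀ n k N q → imageSum n k (+ N - + 2 * q - + 1) N ≡ + 0
  imageSum-odd n k N q =
    cong₂ _+_ (ℤΣ.sum-zero n (λ i → trans (cong (F N) (right (+ N) q (+ l) (+ i))) (F-odd N (q - + l * + i))))
              (ℤΣ.sum-zero n (λ i → trans (cong (F N) (left (+ N) q (+ l) (+ k + + 1 + + i))) (F-odd N (q + + l * (+ k + + 1 + + i)))))
    where
    right : ∀ n q l i → n - + 2 * q - + 1 + + 2 * l * i ≡ n - + 2 * (q - l * i) - + 1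
    right = solve-∀
    left : ∀ n q l j → n - + 2 * q - + 1 - + 2 * l * j ≡ n - + 2 * (q + l * j) - + 1
    left = solve-∀

  imageSum-beyond : ∀ n k M N → N < M → suc M < l ℕ.* suc k → imageSum n k (+ M) N ≡ + 0
  imageSum-beyond n k M N N<M M+1<l[1+k] =
    cong₂ _+_ (ℤΣ.sum-zero n (λ i → F-right-image-vanishes N M i (ℕP.≤-trans N<M (ℕP.m≤m+n M _))))
              (ℤΣ.sum-zero n (λ i → F-left-image-vanishes N M (k ℕ.+ 1 ℕ.+ i) (far i)))
    where
    open ℕP.≤-Reasoning
    far : ∀ i → M ℕ.+ N ℕ.+ 2 < 2 ℕ.* l ℕ.* (k ℕ.+ 1 ℕ.+ i)
    far i = begin-strict
      M ℕ.+ N ℕ.+ 2         <⟨ ℕP.+-monoˡ-< 2 (ℕP.+-monoʳ-< M (ℕP.≤-trans N<M (ℕP.m≤m+n M 2))) ⟩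
      M ℕ.+ (M ℕ.+ 2) ℕ.+ 2 ≡⟨ double M ⟩
      2 ℕ.* suc (suc M)     ≤⟨ ℕP.*-monoʳ-≤ 2 M+1<l[1+k] ⟩
      2 ℕ.* (l ℕ.* suc k)   ≤⟨ ℕP.*-monoʳ-≤ 2 (ℕP.*-monoʳ-≤ l (ℕP.≤-trans (ℕP.≤-reflexive (ℕP.+-comm 1 k)) (ℕP.m≤m+n _ i))) ⟩
      2 ℕ.* (l ℕ.* (k ℕ.+ 1 ℕ.+ i)) ≡⟨ sym (ℕP.*-assoc 2 l _) ⟩
      2 ℕ.* l ℕ.* (k ℕ.+ 1 ℕ.+ i) ∎
      where
      double : ∀ M → M ℕ.+ (M ℕ.+ 2) ℕ.+ 2 ≡ 2 ℕ.* suc (suc M)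
      double = ℕSolver.solve-∀

  imageSum-origin : ∀ n → 0 < n → imageSum n 0 (+ 0) 0 ≡ + 1
  imageSum-origin (suc n) _ = cong₂ _+_
    (cong₂ _+_ (cong (F 0) (origin 2l))
               (ℤΣ.sum-zero n (λ i → F-right-image-vanishes 0 0 (suc i) (ℕP.≤-trans (s≤s z≤n) (4≤2l[1+i] i)))))
    (ℤΣ.sum-zero (suc n) (λ i → F-left-image-vanishes 0 0 (0 ℕ.+ 1 ℕ.+ i) (ℕP.≤-trans (ℕP.n≤1+n 3) (4≤2l[1+i] i))))
    where
    origin : ∀ x → + 0 + x * + 0 ≡ + 0
    origin = solve-∀
    4≤2l[1+i] : ∀ i → 4 ≤ 2 ℕ.* l ℕ.* suc i
    4≤2l[1+i] i = ℕP.≤-trans (ℕP.*-monoʳ-≤ 2 l≥2) (ℕP.m≤m*n (2 ℕ.* l) (suc i))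

  -- The filter of strip k + 1 sits at d = l(k+1) - 1; the long step into d comes from
  -- s = l(k+3) - 2.
  module _ (n k N : ℕ) (N<n : N < n) where
    d⁺ d s : ℤ
    d⁺ = + l * (+ k + + 1)
    d = d⁺ - + 1
    s = + l * (+ k + + 3) - + 2

    right-of-d⁺ : ℕ → ℤ
    right-of-d⁺ i = F N (d⁺ + 2l * + i)

    right-of-d⁺-vanishes : right-of-d⁺ n ≡ + 0
    right-of-d⁺-vanishes =
      trans (cong (λ z → F N (z + 2l * + n)) (sym (pos-* l (k ℕ.+ 1))))
            (F-right-image-vanishes N (l ℕ.* (k ℕ.+ 1)) n
              (ℕP.≤-trans N<n (ℕP.≤-trans (n≤2ln n) (ℕP.m≤n+m _ _))))

    -- Moving the right wall out by l adds exactly one image.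
    imageSum-next-strip : imageSum n (suc k) (d - + 1) N ≡ imageSum n k (d - + 1) N + F N d⁺
    imageSum-next-strip = trans (cong (_+_ S) left-images) (sym (ℤP.+-assoc S (ℤΣ.sum n g) (F N d⁺)))
      where
      open ≡-Reasoning
      S : ℤ
      S = ℤΣ.sum n (λ i → F N (d - + 1 + 2l * + i))
      g : ℕ → ℤ
      g i = F N (d - + 1 - 2l * (+ k + + 1 + + i))
      reindex : ∀ l k i → l * (k + + 1) - + 1 - + 1 - + 2 * l * ((+ 1 + k) + + 1 + i)
                        ≡ l * (k + + 1) - + 1 - + 1 - + 2 * l * (k + + 1 + (+ 1 + i))
      reindex = solve-∀
      mirror : ∀ l k x → l * (k + + 1) - + 1 - + 1 - + 2 * l * (k + + 1 + x) ≡ - (l * (k + + 1) + + 2 * l * x) - + 2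
      mirror = solve-∀
      g≡-right : ∀ i → g i ≡ - right-of-d⁺ i
      g≡-right i = trans (cong (F N) (mirror (+ l) (+ k) (+ i))) (F-reflect N (d⁺ + 2l * + i))
      left-images : ℤΣ.sum n (λ i → F N (d - + 1 - 2l * (+ suc k + + 1 + + i))) ≡ ℤΣ.sum n g + F N d⁺
      left-images = begin
        ℤΣ.sum n (λ i → F N (d - + 1 - 2l * (+ suc k + + 1 + + i))) ≡⟨ ℤΣ.sum-cong n (λ i → cong (F N) (reindex (+ l) (+ k) (+ i))) ⟩
        ℤΣ.sum n (λ i → g (suc i))                                  ≡⟨ sum-shift n g ⟩
        ℤΣ.sum n g - (g 0 - g n)
          ≡⟨ cong (λ z → ℤΣ.sum n g - (z - g n)) (trans (cong (F N) (ends (+ l) (+ k))) (F-reflect N d⁺)) ⟩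
        ℤΣ.sum n g - (- F N d⁺ - g n)
          ≡⟨ cong (λ z → ℤΣ.sum n g - (- F N d⁺ - z)) (trans (g≡-right n) (cong -_ right-of-d⁺-vanishes)) ⟩
        ℤΣ.sum n g - (- F N d⁺ - - + 0)                             ≡⟨ simplify (ℤΣ.sum n g) (F N d⁺) ⟩
        ℤΣ.sum n g + F N d⁺                                          ∎
        where
        ends : ∀ l k → l * (k + + 1) - + 1 - + 1 - + 2 * l * (k + + 1 + + 0) ≡ - (l * (k + + 1)) - + 2
        ends = solve-∀
        simplify : ∀ s f → s - (- f - - + 0) ≡ s + f
        simplify = solve-∀

    imageSum-across-filter : imageSum n (suc k) (d + + 1) N + imageSum n (suc (suc k)) s N ≡ F N d⁺
    imageSum-across-filter = begin
      (ℤΣ.sum n (λ i → F N (d + + 1 + 2l * + i)) + ℤΣ.sum n (λ i → F N (d + + 1 - 2l * (+ suc k + + 1 + + i))))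
        + (T + ℤΣ.sum n (λ i → F N (s - 2l * (+ suc (suc k) + + 1 + + i))))
        ≡⟨ cong₂ _+_ (cong₂ _+_ right-images-of-d⁺ left-images-of-d⁺) (cong (_+_ T) left-images-of-s) ⟩
      (ℤΣ.sum n right-of-d⁺ + - T) + (T + - ℤΣ.sum n (λ i → right-of-d⁺ (suc i)))
        ≡⟨ cancel (ℤΣ.sum n right-of-d⁺) T _ ⟩
      ℤΣ.sum n right-of-d⁺ - ℤΣ.sum n (λ i → right-of-d⁺ (suc i))
        ≡⟨ sum-telescope n right-of-d⁺ ⟩
      right-of-d⁺ 0 - right-of-d⁺ n
        ≡⟨ cong₂ _-_ (cong (F N) (origin d⁺ 2l)) right-of-d⁺-vanishes ⟩
      F N d⁺ - + 0
        ≡⟨ ℤP.+-identityʳ (F N d⁺) ⟩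
      F N d⁺ ∎
      where
      open ≡-Reasoning
      T : ℤ
      T = ℤΣ.sum n (λ i → F N (s + 2l * + i))
      above : ∀ l k x → l * (k + + 1) - + 1 + + 1 + x ≡ l * (k + + 1) + x
      above = solve-∀
      mirror-d⁺ : ∀ l k i → l * (k + + 1) - + 1 + + 1 - + 2 * l * ((+ 1 + k) + + 1 + i) ≡ - ((l * (k + + 3) - + 2) + + 2 * l * i) - + 2
      mirror-d⁺ = solve-∀
      mirror-s : ∀ l k i → (l * (k + + 3) - + 2) - + 2 * l * ((+ 1 + (+ 1 + k)) + + 1 + i) ≡ - (l * (k + + 1) + + 2 * l * (+ 1 + i)) - + 2
      mirror-s = solve-∀
      origin : ∀ y x → y + x * + 0 ≡ y
      origin = solve-∀
      cancel : ∀ s t u → (s + - t) + (t + - u) ≡ s + - u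
      cancel = solve-∀
      right-images-of-d⁺ : ℤΣ.sum n (λ i → F N (d + + 1 + 2l * + i)) ≡ ℤΣ.sum n right-of-d⁺
      right-images-of-d⁺ = ℤΣ.sum-cong n (λ i → cong (F N) (above (+ l) (+ k) (2l * + i)))
      left-images-of-d⁺ : ℤΣ.sum n (λ i → F N (d + + 1 - 2l * (+ suc k + + 1 + + i))) ≡ - T
      left-images-of-d⁺ = trans (ℤΣ.sum-cong n (λ i → trans (cong (F N) (mirror-d⁺ (+ l) (+ k) (+ i))) (F-reflect N (s + 2l * + i))))
                                 (sum-neg n _)
      left-images-of-s : ℤΣ.sum n (λ i → F N (s - 2l * (+ suc (suc k) + + 1 + + i))) ≡ - ℤΣ.sum n (λ i → right-of-d⁺ (suc i))
      left-images-of-s = trans (ℤΣ.sum-cong n (λ i → trans (cong (F N) (mirror-s (+ l) (+ k) (+ i))) (F-reflect N (d⁺ + 2l * + suc i))))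
                               (sum-neg n _)

    imageSum-filter : imageSum n (suc k) d (suc N) ≡
      imageSum n k (d - + 1) N + (imageSum n (suc k) (d + + 1) N + imageSum n (suc k) (d + + 1) N) + imageSum n (suc (suc k)) s N
    imageSum-filter = begin
      imageSum n (suc k) d (suc N)       ≡⟨ imageSum-pascal n (suc k) d N ⟩
      imageSum n (suc k) (d - + 1) N + X ≡⟨ cong (_+ X) imageSum-next-strip ⟩
      (W + F N d⁺) + X                    ≡⟨ cong (λ z → (W + z) + X) (sym imageSum-across-filter) ⟩
      (W + (X + Y)) + X                  ≡⟨ regroup W X Y ⟩
      W + (X + X) + Y                    ∎
      where
      open ≡-Reasoning
      W X Y : ℤ
      W = imageSum n k (d - + 1) N
      X = imageSum n (suc k) (d + + 1) N
      Y = imageSum n (suc (suc k)) s N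
      regroup : ∀ W X Y → (W + (X + Y)) + X ≡ W + (X + X) + Y
      regroup = solve-∀

    imageSum-at-filter : ∀ p → suc (suc p) ≡ l ℕ.* suc k → imageSum n (suc k) (+ suc p) (suc N) ≡
      imageSum n k (+ p) N + (imageSum n (suc k) (+ suc (suc p)) N + imageSum n (suc k) (+ suc (suc p)) N)
        + imageSum n (suc (suc k)) (+ (p ℕ.+ 2 ℕ.* l)) N
    imageSum-at-filter p eq = begin
      imageSum n (suc k) (+ suc p) (suc N) ≡⟨ cong (λ z → imageSum n (suc k) z (suc N)) (sym d≡) ⟩
      imageSum n (suc k) d (suc N)         ≡⟨ imageSum-filter ⟩
      W k (d - + 1) + (W (suc k) (d + + 1) + W (suc k) (d + + 1)) + W (suc (suc k)) s
        ≡⟨ cong₂ _+_ (cong₂ _+_ (cong (W k) d-1≡) (cong (λ z → W (suc k) z + W (suc k) z) d+1≡)) (cong (W (suc (suc k))) s≡) ⟩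
      W k (+ p) + (W (suc k) (+ suc (suc p)) + W (suc k) (+ suc (suc p))) + W (suc (suc k)) (+ (p ℕ.+ 2 ℕ.* l)) ∎
      where
      open ≡-Reasoning
      W : ℕ → ℤ → ℤ
      W j m = imageSum n j m N
      d⁺≡ : d⁺ ≡ + suc (suc p)
      d⁺≡ = sym (trans (cong +_ (trans eq (cong (l ℕ.*_) (ℕP.+-comm 1 k)))) (pos-* l (k ℕ.+ 1)))
      d≡ : d ≡ + suc p
      d≡ = trans (cong (_- + 1) d⁺≡) (drop (+ p))
        where
        drop : ∀ x → (+ 1 + (+ 1 + x)) - + 1 ≡ + 1 + x
        drop = solve-∀
      d-1≡ : d - + 1 ≡ + p
      d-1≡ = trans (cong (_- + 1) d≡) (drop (+ p))
        where
        drop : ∀ x → (+ 1 + x) - + 1 ≡ x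
        drop = solve-∀
      d+1≡ : d + + 1 ≡ + suc (suc p)
      d+1≡ = trans (cong (_+ + 1) d≡) (lift (+ p))
        where
        lift : ∀ x → (+ 1 + x) + + 1 ≡ + 1 + (+ 1 + x)
        lift = solve-∀
      s≡ : s ≡ + (p ℕ.+ 2 ℕ.* l)
      s≡ = begin
        + l * (+ k + + 3) - + 2       ≡⟨ split (+ l) (+ k) ⟩
        d⁺ + + 2 * + l - + 2          ≡⟨ cong (λ z → z + + 2 * + l - + 2) d⁺≡ ⟩
        + suc (suc p) + + 2 * + l - + 2 ≡⟨ drop (+ p) (+ l) ⟩
        + p + + 2 * + l               ≡⟨ cong (_+_ (+ p)) (sym (pos-* 2 l)) ⟩
        + (p ℕ.+ 2 ℕ.* l)             ∎
        where
        split : ∀ l k → l * (k + + 3) - + 2 ≡ l * (k + + 1) + + 2 * l - + 2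
        split = solve-∀
        drop : ∀ p l → (+ 1 + (+ 1 + p)) + + 2 * l - + 2 ≡ p + + 2 * l
        drop = solve-∀

module TransferEquation (l : ℕ) (l≥2 : 2 ≤ l) where
  open import Data.Nat using (_+_; _*_; _∸_)

  Z : ℕ → ℕ → ℕ
  Z = zU l

  downWeight : ℕ → ℕ
  downWeight zero    = 0
  downWeight (suc p) = if does (l ∣? suc (suc p)) then 0 else (if does (l ∣? suc p) then 2 else 1)

  elemW-split : ∀ x x' → elemW l x x' ≡ (if x' ≡ᵇ suc x then 1 else 0) + (if suc x' ≡ᵇ x then downWeight x else 0)
  elemW-split zero    x' = sym (ℕP.+-identityʳ _)
  elemW-split (suc p) x' with does (l ∣? suc (suc p))
  ... | true  = sym (trans (cong (_+_ (if x' ≡ᵇ suc (suc p) then 1 else 0)) (if-0 (suc x' ≡ᵇ suc p))) (ℕP.+-identityʳ _))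
    where
    if-0 : ∀ b → (if b then 0 else 0) ≡ 0
    if-0 true  = refl
    if-0 false = refl
  ... | false with does (l ∣? suc p)
  ...   | true  = refl
  ...   | false = refl

  zU-left : ℕ → ℕ → ℕ
  zU-left y zero    = 0
  zU-left y (suc p) = Z y p

  longSteps : ℕ → ℕ → ℕ
  longSteps y x' = ℕΣ.sum (x' + 2 * l) (λ x → longW l x y x' * Z y x)

  zU-suc : ∀ y x' → Z (suc y) x' ≡ zU-left y x' + downWeight (suc x') * Z y (suc x') + longSteps y x'
  zU-suc y x' = begin
    Z (suc y) x'
      ≡⟨ ℕΣ.sum-foldr R _ id ⟩
    ℕΣ.sum R (λ x → (elemW l x x' + longW l x y x') * Z y x)
      ≡⟨ trans (ℕΣ.sum-cong R (λ x → ℕP.*-distribʳ-+ (Z y x) (elemW l x x') _)) (ℕΣ.sum-distrib R _ _) ⟩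
    ℕΣ.sum R (λ x → elemW l x x' * Z y x) + longSteps y x'
      ≡⟨ cong (ℕ._+ longSteps y x') elementary ⟩
    zU-left y x' + downWeight (suc x') * Z y (suc x') + longSteps y x' ∎
    where
    open ≡-Reasoning
    R : ℕ
    R = x' + 2 * l
    up : Bool → ℕ → ℕ
    up b x = (if b then 1 else 0) * Z y x
    from-left : ∀ x' → ℕΣ.sum (x' + 2 * l) (λ x → up (x' ≡ᵇ suc x) x) ≡ zU-left y x'
    from-left zero    = ℕΣ.sum-zero (2 * l) (λ x → refl)
    from-left (suc p) = trans (ℕΣ.sum-single (suc p + 2 * l) p (s≤s (ℕP.m≤m+n p _))
                                 (λ x x≢p → cong (λ b → up b x) (dec-false (p ℕ.≟ x) (x≢p ∘ sym))))
                              (trans (cong (λ b → up b p) (dec-true (p ℕ.≟ p) refl)) (ℕP.+-identityʳ _))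
    from-right : ℕΣ.sum R (λ x → (if suc x' ≡ᵇ x then downWeight x else 0) * Z y x) ≡ downWeight (suc x') * Z y (suc x')
    from-right = trans (ℕΣ.sum-single R (suc x') x'+1<R
                         (λ x x≢ → cong (λ b → (if b then downWeight x else 0) * Z y x) (dec-false (suc x' ℕ.≟ x) (x≢ ∘ sym))))
                       (cong (λ b → (if b then downWeight (suc x') else 0) * Z y (suc x')) (dec-true (x' ℕ.≟ x') refl))
      where
      x'+1<R : suc x' < R
      x'+1<R = ℕP.≤-trans (ℕP.≤-reflexive (ℕP.+-comm 2 x')) (ℕP.+-monoʳ-≤ x' (ℕP.≤-trans l≥2 (ℕP.m≤m+n l _)))
    elementary : ℕΣ.sum R (λ x → elemW l x x' * Z y x) ≡ zU-left y x' + downWeight (suc x') * Z y (suc x')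
    elementary = trans (ℕΣ.sum-cong R split) (trans (ℕΣ.sum-distrib R _ _) (cong₂ _+_ (from-left x') from-right))
      where
      split : ∀ x → elemW l x x' * Z y x
                  ≡ up (x' ≡ᵇ suc x) x + (if suc x' ≡ᵇ x then downWeight x else 0) * Z y x
      split x = trans (cong (_* Z y x) (elemW-split x x'))
                      (ℕP.*-distribʳ-+ (Z y x) (if x' ≡ᵇ suc x then 1 else 0) (if suc x' ≡ᵇ x then downWeight x else 0))

  instance
    l-nonZero : ℕ.NonZero l
    l-nonZero = ℕ.>-nonZero (ℕP.≤-trans (s≤s z≤n) l≥2)

  longStep : ℕ → ℕ → ℕ → ℕ → ℕ → ℕ
  longStep x y x' K m = if (x ≡ᵇ (l * (K + 2) ∸ 2)) ∧ (y ≡ᵇ (l * K ∸ 2 + 2 * m)) ∧ (x' ≡ᵇ (l * K ∸ 1)) then 1 else 0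

  longW-sum : ∀ x y x' → longW l x y x' ≡ ℕΣ.sum (suc x') (λ K → ℕΣ.sum (suc y) (λ m → longStep x y x' (suc K) m))
  longW-sum x y x' = trans (ℕΣ.sum-foldr (suc x') _ id)
                           (ℕΣ.sum-cong (suc x') (λ K → ℕΣ.sum-foldr (suc y) (λ m → longStep x y x' (suc K) m) id))

  longStep-wrong-target : ∀ x y x' K m → x' ≢ l * K ∸ 1 → longStep x y x' K m ≡ 0
  longStep-wrong-target x y x' K m x'≢ rewrite dec-false (x' ℕ.≟ l * K ∸ 1) x'≢ | ∧-zeroʳ (y ≡ᵇ (l * K ∸ 2 + 2 * m))
    | ∧-zeroʳ (x ≡ᵇ (l * (K + 2) ∸ 2)) = refl

  longStep-wrong-source : ∀ x y x' K m → x ≢ l * (K + 2) ∸ 2 → longStep x y x' K m ≡ 0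
  longStep-wrong-source x y x' K m x≢ rewrite dec-false (x ℕ.≟ l * (K + 2) ∸ 2) x≢ = refl

  l[1+K]∸1+1 : ∀ K → suc (l * suc K ∸ 1) ≡ l * suc K
  l[1+K]∸1+1 K = trans (ℕP.+-comm 1 _) (ℕP.m∸n+n≡m (ℕP.≤-trans (ℕP.≤-trans (s≤s z≤n) l≥2) (ℕP.m≤m*n l (suc K))))

  longW-off-filter : ∀ x y x' → ¬ (l ∣ suc x') → longW l x y x' ≡ 0
  longW-off-filter x y x' l∤ = trans (longW-sum x y x') (ℕΣ.sum-zero (suc x') (λ K → ℕΣ.sum-zero (suc y) (λ m →
    longStep-wrong-target x y x' (suc K) m (λ eq → l∤ (divides (suc K) (trans (cong suc eq) (trans (l[1+K]∸1+1 K) (ℕP.*-comm l (suc K)))))))))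

  evenGap : ℕ → ℕ → ℕ
  evenGap y p = ℕΣ.sum (suc y) (λ m → if y ≡ᵇ p + 2 * m then 1 else 0)

  evenGap-even : ∀ y p m → y ≡ p + 2 * m → evenGap y p ≡ 1
  evenGap-even y p m₀ eq = trans (ℕΣ.sum-single (suc y) m₀ m₀<1+y
      (λ m m≢m₀ → cong (λ b → if b then 1 else 0) (dec-false (y ℕ.≟ p + 2 * m)
                    (λ eq' → m≢m₀ (ℕP.*-cancelˡ-≡ m m₀ 2 (ℕP.+-cancelˡ-≡ p _ _ (trans (sym eq') eq)))))))
    (cong (λ b → if b then 1 else 0) (dec-true (y ℕ.≟ p + 2 * m₀) eq))
    where
    m₀<1+y : m₀ < suc y
    m₀<1+y = s≤s (ℕP.≤-trans (ℕP.m≤m+n m₀ (m₀ + 0)) (ℕP.≤-trans (ℕP.m≤n+m (2 * m₀) p) (ℕP.≤-reflexive (sym eq))))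

  evenGap-odd : ∀ y p → (∀ m → y ≢ p + 2 * m) → evenGap y p ≡ 0
  evenGap-odd y p ≢ = ℕΣ.sum-zero (suc y) (λ m → cong (λ b → if b then 1 else 0) (dec-false (y ℕ.≟ p + 2 * m) (≢ m)))

  longSteps-into-filter : ∀ y p K → suc (suc p) ≡ l * suc K → longSteps y (suc p) ≡ evenGap y p * Z y (p + 2 * l)
  longSteps-into-filter y p K₀ eq =
    trans (ℕΣ.sum-single (suc p + 2 * l) (p + 2 * l) (ℕP.n<1+n _) other-sources) (cong (_* Z y (p + 2 * l)) from-source)
    where
    source : l * (suc K₀ + 2) ∸ 2 ≡ p + 2 * l
    source rewrite ℕP.*-distribˡ-+ l (suc K₀) 2 | sym eq = cong (_+_ p) (ℕP.*-comm l 2)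
    index : ∀ K → suc p ≡ l * suc K ∸ 1 → K ≡ K₀
    index K eq' = ℕP.suc-injective (ℕP.*-cancelˡ-≡ (suc K) (suc K₀) l (trans (sym (l[1+K]∸1+1 K)) (trans (cong suc (sym eq')) eq)))
    other-sources : ∀ x → x ≢ p + 2 * l → longW l x y (suc p) * Z y x ≡ 0
    other-sources x x≢ = cong (_* Z y x) (trans (longW-sum x y (suc p))
      (ℕΣ.sum-zero (suc (suc p)) (λ K → ℕΣ.sum-zero (suc y) (λ m → no-step K m))))
      where
      no-step : ∀ K m → longStep x y (suc p) (suc K) m ≡ 0
      no-step K m with K ℕ.≟ K₀
      ... | yes refl = longStep-wrong-source x y (suc p) (suc K) m (λ eq' → x≢ (trans eq' source))
      ... | no K≢K₀  = longStep-wrong-target x y (suc p) (suc K) m (K≢K₀ ∘ index K)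
    from-source : longW l (p + 2 * l) y (suc p) ≡ evenGap y p
    from-source = trans (longW-sum (p + 2 * l) y (suc p))
                    (trans (ℕΣ.sum-single (suc (suc p)) K₀ K₀<p+2 other-indices) (ℕΣ.sum-cong (suc y) height))
      where
      K₀<p+2 : K₀ < suc (suc p)
      K₀<p+2 = ℕP.≤-trans (ℕP.m≤n*m (suc K₀) l) (ℕP.≤-reflexive (sym eq))
      other-indices : ∀ K → K ≢ K₀ → ℕΣ.sum (suc y) (λ m → longStep (p + 2 * l) y (suc p) (suc K) m) ≡ 0
      other-indices K K≢K₀ = ℕΣ.sum-zero (suc y) (λ m → longStep-wrong-target (p + 2 * l) y (suc p) (suc K) m (K≢K₀ ∘ index K))
      height : ∀ m → longStep (p + 2 * l) y (suc p) (suc K₀) m ≡ (if y ≡ᵇ p + 2 * m then 1 else 0)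
      height m rewrite dec-true (p + 2 * l ℕ.≟ l * (suc K₀ + 2) ∸ 2) (sym source)
                     | dec-true (suc p ℕ.≟ l * suc K₀ ∸ 1) (cong (_∸ 1) eq) | sym eq
                     | ∧-identityʳ (y ≡ᵇ p + 2 * m) = refl

  ∤-strictly-between : ∀ k t → l * k < t → t < l * suc k → ¬ (l ∣ t)
  ∤-strictly-between k t lk<t t<l[1+k] (divides q refl) = ℕP.<-irrefl refl (ℕP.≤-trans (s≤s k<q) q<1+k)
    where
    k<q : k < q
    k<q = ℕP.*-cancelˡ-< l k q (ℕP.≤-trans lk<t (ℕP.≤-reflexive (ℕP.*-comm q l)))
    q<1+k : q < suc k
    q<1+k = ℕP.*-cancelˡ-< l q (suc k) (ℕP.≤-trans (ℕP.≤-reflexive (cong suc (ℕP.*-comm l q))) t<l[1+k])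

  ∣⇒∤suc : ∀ t → l ∣ t → ¬ (l ∣ suc t)
  ∣⇒∤suc t l∣t l∣1+t with subst (2 ≤_) (∣1⇒≡1 (∣m+n∣m⇒∣n (subst (l ∣_) (ℕP.+-comm 1 t) l∣1+t) l∣t)) l≥2
  ... | s≤s ()

  downWeight-ordinary : ∀ p → ¬ (l ∣ suc (suc p)) → ¬ (l ∣ suc p) → downWeight (suc p) ≡ 1
  downWeight-ordinary p l∤p+2 l∤p+1 rewrite dec-false (l ∣? suc (suc p)) l∤p+2 | dec-false (l ∣? suc p) l∤p+1 = refl

  downWeight-filter : ∀ p → l ∣ suc (suc p) → downWeight (suc p) ≡ 0
  downWeight-filter p l∣p+2 rewrite dec-true (l ∣? suc (suc p)) l∣p+2 = refl

  downWeight-after-filter : ∀ p → l ∣ suc p → downWeight (suc p) ≡ 2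
  downWeight-after-filter p l∣p+1 rewrite dec-false (l ∣? suc (suc p)) (∣⇒∤suc (suc p) l∣p+1) | dec-true (l ∣? suc p) l∣p+1 = refl

module Agreement (l : ℕ) (l≥2 : 2 ≤ l) where
  open import Data.Nat using (_+_; _*_; _∸_)
  open ImageSums l l≥2
  open TransferEquation l l≥2

  -- M lies in the strip k, and n > N terms of each kind suffice.
  Agrees : ℕ → Set
  Agrees N = ∀ n k M → l * k ≤ suc M → suc M < l * suc k → N < n → + Z N M ≡ imageSum n k (+ M) N

  2≤l[1+k] : ∀ k → 2 ≤ l * suc k
  2≤l[1+k] k = ℕP.≤-trans l≥2 (ℕP.m≤m*n l (suc k))

  agrees-0 : Agrees 0
  agrees-0 n zero    zero    _    _   0<n = sym (imageSum-origin n 0<n)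
  agrees-0 n (suc k) zero    lk≤1 _   _   = ⊥-elim (ℕP.<-irrefl refl (ℕP.≤-trans (2≤l[1+k] k) lk≤1))
  agrees-0 n k       (suc M) _    M+2<l[1+k] _ = sym (imageSum-beyond n k (suc M) 0 (s≤s z≤n) M+2<l[1+k])

  data Position : ℕ → ℕ → Set where
    at-filter     : ∀ k p → suc (suc p) ≡ l * suc k → Position (suc k) (suc p)
    at-right-edge : ∀ {k M} → l * k ≤ M → suc (suc M) ≡ l * suc k → Position k M
    inside        : ∀ {k M} → l * k ≤ M → suc (suc M) < l * suc k → Position k M

  position : ∀ k M → l * k ≤ suc M → suc M < l * suc k → Position k M
  position k M lk≤1+M 1+M<l[1+k] with l * k ℕ.≟ suc M
  position zero    M       _ _ | yes eq = ⊥-elim (ℕP.0≢1+n (trans (sym (ℕP.*-zeroʳ l)) eq))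
  position (suc k) zero    _ _ | yes eq = ⊥-elim (ℕP.<-irrefl (sym eq) (2≤l[1+k] k))
  position (suc k) (suc p) _ _ | yes eq = at-filter k p (sym eq)
  position k M lk≤1+M 1+M<l[1+k] | no lk≢1+M with suc (suc M) ℕ.≟ l * suc k
  ... | yes eq = at-right-edge (ℕP.≤-pred (ℕP.≤∧≢⇒< lk≤1+M lk≢1+M)) eq
  ... | no  ≢  = inside (ℕP.≤-pred (ℕP.≤∧≢⇒< lk≤1+M lk≢1+M)) (ℕP.≤∧≢⇒< 1+M<l[1+k] ≢)

  -- Around the filter p + 1 = l(k+1) - 1: its neighbours p, p + 2 and the long-step
  -- source p + 2l lie in the strips k, k + 1 and k + 2.
  module _ (k p : ℕ) (2+p≡ : suc (suc p) ≡ l * suc k) where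

    l[2+k]≡ : l * suc (suc k) ≡ l + suc (suc p)
    l[2+k]≡ = trans (ℕP.*-suc l (suc k)) (cong (_+_ l) (sym 2+p≡))

    l[3+k]≡ : l * suc (suc (suc k)) ≡ suc (suc (p + 2 * l))
    l[3+k]≡ = trans (ℕP.*-suc l (suc (suc k))) (trans (cong (_+_ l) l[2+k]≡) (ring l p))
      where
      ring : ∀ l p → l + (l + suc (suc p)) ≡ suc (suc (p + 2 * l))
      ring = ℕSolver.solve-∀

    source-top : suc (p + 2 * l) < l * suc (suc (suc k))
    source-top = ℕP.≤-reflexive (sym l[3+k]≡)

    lower-neighbour-bottom : l * k ≤ suc p
    lower-neighbour-bottom = ℕP.m≤n⇒m≤1+n (ℕP.≤-pred (ℕP.≤-pred
      (ℕP.≤-trans (ℕP.+-monoˡ-≤ (l * k) l≥2) (ℕP.≤-reflexive (trans (sym (ℕP.*-suc l k)) (sym 2+p≡))))))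

    upper-neighbour-bottom : l * suc k ≤ suc (suc (suc p))
    upper-neighbour-bottom = ℕP.≤-trans (ℕP.≤-reflexive (sym 2+p≡)) (ℕP.n≤1+n (suc (suc p)))

    upper-neighbour-top : suc (suc (suc p)) < l * suc (suc k)
    upper-neighbour-top = ℕP.≤-trans (ℕP.+-monoˡ-≤ (suc (suc p)) l≥2) (ℕP.≤-reflexive (sym l[2+k]≡))

    source-bottom : l * suc (suc k) ≤ suc (p + 2 * l)
    source-bottom = begin
      l * suc (suc k)      ≡⟨ l[2+k]≡ ⟩
      l + suc (suc p)      ≡⟨ shuffle l p ⟩
      suc (1 + (p + l))    ≤⟨ s≤s (ℕP.+-monoˡ-≤ (p + l) (ℕP.≤-trans (s≤s z≤n) l≥2)) ⟩
      suc (l + (p + l))    ≡⟨ cong suc (regroup l p) ⟩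
      suc (p + 2 * l)      ∎
      where
      open ℕP.≤-Reasoning
      shuffle : ∀ l p → l + suc (suc p) ≡ suc (1 + (p + l))
      shuffle = ℕSolver.solve-∀
      regroup : ∀ l p → l + (p + l) ≡ p + 2 * l
      regroup = ℕSolver.solve-∀

  module Step (N : ℕ) (ih : Agrees N) (n : ℕ) (N<n : N < n) where

    zU-left-agrees : ∀ k M → l * k ≤ M → M < l * suc k → + zU-left N M ≡ imageSum n k (+ M ℤ.- + 1) N
    zU-left-agrees zero    zero    _    _ = sym (imageSum-left-wall n N N<n)
    zU-left-agrees (suc k) zero    lk≤0 _ with ℕP.≤-trans (2≤l[1+k] k) lk≤0
    ... | ()
    zU-left-agrees k       (suc p) lk≤1+p 1+p<l[1+k] = ih n k p lk≤1+p 1+p<l[1+k] N<n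

    no-long-steps : ∀ M → ¬ (l ∣ suc M) → longSteps N M ≡ 0
    no-long-steps M l∤1+M = ℕΣ.sum-zero (M + 2 * l) (λ x → cong (_* Z N x) (longW-off-filter x N M l∤1+M))

    agrees-inside : ∀ k M → l * k ≤ M → suc (suc M) < l * suc k → + Z (suc N) M ≡ imageSum n k (+ M) (suc N)
    agrees-inside k M lk≤M 2+M<l[1+k] = begin
      + Z (suc N) M
        ≡⟨ cong +_ (trans (zU-suc N M) (cong₂ (λ w s → zU-left N M + w * Z N (suc M) + s) weight-1 (no-long-steps M l∤1+M))) ⟩
      + (zU-left N M + 1 * Z N (suc M) + 0)
        ≡⟨ cong +_ (simplify (zU-left N M) (Z N (suc M))) ⟩
      + zU-left N M ℤ.+ + Z N (suc M)
        ≡⟨ cong₂ ℤ._+_ (zU-left-agrees k M lk≤M (ℕP.<-trans (ℕP.n<1+n M) 1+M<l[1+k]))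
                       (trans (ih n k (suc M) (ℕP.m≤n⇒m≤1+n (ℕP.m≤n⇒m≤1+n lk≤M)) 2+M<l[1+k] N<n)
                              (cong (λ z → imageSum n k z N) (cong +_ (ℕP.+-comm 1 M)))) ⟩
      imageSum n k (+ M ℤ.- + 1) N ℤ.+ imageSum n k (+ M ℤ.+ + 1) N
        ≡⟨ sym (imageSum-pascal n k (+ M) N) ⟩
      imageSum n k (+ M) (suc N) ∎
      where
      open ≡-Reasoning
      simplify : ∀ a b → a + 1 * b + 0 ≡ a + b
      simplify = ℕSolver.solve-∀
      1+M<l[1+k] : suc M < l * suc k
      1+M<l[1+k] = ℕP.<-trans (ℕP.n<1+n (suc M)) 2+M<l[1+k]
      l∤1+M : ¬ (l ∣ suc M)
      l∤1+M = ∤-strictly-between k (suc M) (s≤s lk≤M) 1+M<l[1+k]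
      weight-1 : downWeight (suc M) ≡ 1
      weight-1 = downWeight-ordinary M (∤-strictly-between k (suc (suc M)) (s≤s (ℕP.m≤n⇒m≤1+n lk≤M)) 2+M<l[1+k]) l∤1+M

    agrees-right-edge : ∀ k M → l * k ≤ M → suc (suc M) ≡ l * suc k → + Z (suc N) M ≡ imageSum n k (+ M) (suc N)
    agrees-right-edge k M lk≤M 2+M≡ = begin
      + Z (suc N) M
        ≡⟨ cong +_ (trans (zU-suc N M) (cong₂ (λ w s → zU-left N M + w * Z N (suc M) + s) weight-0 (no-long-steps M l∤1+M))) ⟩
      + (zU-left N M + 0 * Z N (suc M) + 0)
        ≡⟨ cong +_ (simplify (zU-left N M) (Z N (suc M))) ⟩
      + zU-left N M
        ≡⟨ zU-left-agrees k M lk≤M (ℕP.≤-trans (ℕP.n≤1+n (suc M)) (ℕP.≤-reflexive 2+M≡)) ⟩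
      imageSum n k (+ M ℤ.- + 1) N
        ≡⟨ sym (ℤP.+-identityʳ _) ⟩
      imageSum n k (+ M ℤ.- + 1) N ℤ.+ + 0
        ≡⟨ cong (ℤ._+_ (imageSum n k (+ M ℤ.- + 1) N)) (sym (trans (cong (λ z → imageSum n k z N) wall) (imageSum-right-wall n k N))) ⟩
      imageSum n k (+ M ℤ.- + 1) N ℤ.+ imageSum n k (+ M ℤ.+ + 1) N
        ≡⟨ sym (imageSum-pascal n k (+ M) N) ⟩
      imageSum n k (+ M) (suc N) ∎
      where
      open ≡-Reasoning
      simplify : ∀ a b → a + 0 * b + 0 ≡ a
      simplify = ℕSolver.solve-∀
      l∣2+M : l ∣ suc (suc M)
      l∣2+M = divides (suc k) (trans 2+M≡ (ℕP.*-comm l (suc k)))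
      l∤1+M : ¬ (l ∣ suc M)
      l∤1+M l∣1+M = ∣⇒∤suc (suc M) l∣1+M l∣2+M
      weight-0 : downWeight (suc M) ≡ 0
      weight-0 = downWeight-filter M l∣2+M
      wall : + M ℤ.+ + 1 ≡ + l ℤ.* (+ k ℤ.+ + 1) ℤ.- + 1
      wall = trans (back (+ M)) (cong (ℤ._- + 1) (trans (cong +_ (trans 2+M≡ (cong (l *_) (ℕP.+-comm 1 k)))) (pos-* l (k + 1))))
        where
        back : ∀ m → m ℤ.+ + 1 ≡ (+ 1 ℤ.+ (+ 1 ℤ.+ m)) ℤ.- + 1
        back = solve-∀

    -- A long step from p + 2l at height N can only be taken when N - p is even and
    -- nonnegative; otherwise the image sum at p + 2l vanishes, by parity or by distance.
    long-step-agrees : ∀ k p → suc (suc p) ≡ l * suc k →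
      + (evenGap N p * Z N (p + 2 * l)) ≡ imageSum n (suc (suc k)) (+ (p + 2 * l)) N
    long-step-agrees k p 2+p≡ with p ℕ.≤? N
    ... | no p≰N = trans (cong (λ c → + (c * Z N (p + 2 * l))) (evenGap-odd N p too-low))
                         (sym (imageSum-beyond n (suc (suc k)) (p + 2 * l) N too-far (source-top k p 2+p≡)))
      where
      too-low : ∀ m → N ≢ p + 2 * m
      too-low m eq = p≰N (ℕP.≤-trans (ℕP.m≤m+n p (2 * m)) (ℕP.≤-reflexive (sym eq)))
      too-far : N < p + 2 * l
      too-far = ℕP.≤-trans (ℕP.≰⇒> p≰N) (ℕP.m≤m+n p (2 * l))
    ... | yes p≤N with even-or-odd (N ∸ p)
    ...   | m , inj₁ N∸p≡2m = trans (cong (λ c → + (c * Z N (p + 2 * l))) (evenGap-even N p m N≡))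
                                  (trans (cong +_ (ℕP.*-identityˡ _))
                                         (ih n (suc (suc k)) (p + 2 * l) (source-bottom k p 2+p≡) (source-top k p 2+p≡) N<n))
      where
      N≡ : N ≡ p + 2 * m
      N≡ = trans (sym (ℕP.m+[n∸m]≡n p≤N)) (cong (_+_ p) N∸p≡2m)
    ...   | m , inj₂ N∸p≡2m+1 = trans (cong (λ c → + (c * Z N (p + 2 * l))) (evenGap-odd N p not-even))
                                 (sym (trans (cong (λ z → imageSum n (suc (suc k)) z N) shape) (imageSum-odd n (suc (suc k)) N (+ m ℤ.- + l))))
      where
      N≡ : N ≡ p + (2 * m + 1)
      N≡ = trans (sym (ℕP.m+[n∸m]≡n p≤N)) (cong (_+_ p) N∸p≡2m+1)
      not-even : ∀ m' → N ≢ p + 2 * m'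
      not-even m' eq = 2∤2q+1 m (divides m' (trans (ℕP.+-cancelˡ-≡ p _ _ (trans (sym N≡) eq)) (ℕP.*-comm 2 m')))
      shape : + (p + 2 * l) ≡ + N ℤ.- + 2 ℤ.* (+ m ℤ.- + l) ℤ.- + 1
      shape = trans (cong (ℤ._+_ (+ p)) (pos-* 2 l))
                    (trans (ring (+ p) (+ m) (+ l)) (cong (λ z → z ℤ.- + 2 ℤ.* (+ m ℤ.- + l) ℤ.- + 1) (sym +N≡)))
        where
        +N≡ : + N ≡ + p ℤ.+ (+ 2 ℤ.* + m ℤ.+ + 1)
        +N≡ = trans (cong +_ N≡) (cong (λ z → + p ℤ.+ (z ℤ.+ + 1)) (pos-* 2 m))
        ring : ∀ p m l → p ℤ.+ + 2 ℤ.* l ≡ (p ℤ.+ (+ 2 ℤ.* m ℤ.+ + 1)) ℤ.- + 2 ℤ.* (m ℤ.- l) ℤ.- + 1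
        ring = solve-∀

    agrees-filter : ∀ k p → suc (suc p) ≡ l * suc k → + Z (suc N) (suc p) ≡ imageSum n (suc k) (+ suc p) (suc N)
    agrees-filter k p 2+p≡ = begin
      + Z (suc N) (suc p)
        ≡⟨ cong +_ (trans (zU-suc N (suc p))
                          (cong₂ (λ w s → Z N p + w * Z N (suc (suc p)) + s) weight-2 (longSteps-into-filter N p k 2+p≡))) ⟩
      + (Z N p + 2 * Z N (suc (suc p)) + evenGap N p * Z N (p + 2 * l))
        ≡⟨ cong +_ (double (Z N p) (Z N (suc (suc p))) _) ⟩
      + Z N p ℤ.+ (+ Z N (suc (suc p)) ℤ.+ + Z N (suc (suc p))) ℤ.+ + (evenGap N p * Z N (p + 2 * l))
        ≡⟨ cong₂ ℤ._+_ (cong₂ ℤ._+_ lower (cong₂ ℤ._+_ upper upper)) (long-step-agrees k p 2+p≡) ⟩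
      imageSum n k (+ p) N ℤ.+ (imageSum n (suc k) (+ suc (suc p)) N ℤ.+ imageSum n (suc k) (+ suc (suc p)) N)
        ℤ.+ imageSum n (suc (suc k)) (+ (p + 2 * l)) N
        ≡⟨ sym (imageSum-at-filter n k N N<n p 2+p≡) ⟩
      imageSum n (suc k) (+ suc p) (suc N) ∎
      where
      open ≡-Reasoning
      double : ∀ a b c → a + 2 * b + c ≡ a + (b + b) + c
      double = ℕSolver.solve-∀
      weight-2 : downWeight (suc (suc p)) ≡ 2
      weight-2 = downWeight-after-filter (suc p) (divides (suc k) (trans 2+p≡ (ℕP.*-comm l (suc k))))
      lower : + Z N p ≡ imageSum n k (+ p) N
      lower = ih n k p (lower-neighbour-bottom k p 2+p≡) (ℕP.≤-reflexive 2+p≡) N<n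
      upper : + Z N (suc (suc p)) ≡ imageSum n (suc k) (+ suc (suc p)) N
      upper = ih n (suc k) (suc (suc p)) (upper-neighbour-bottom k p 2+p≡) (upper-neighbour-top k p 2+p≡) N<n

  agrees-suc : ∀ N → Agrees N → Agrees (suc N)
  agrees-suc N ih n k M lk≤1+M 1+M<l[1+k] 1+N<n = step (position k M lk≤1+M 1+M<l[1+k])
    where
    open Step N ih n (ℕP.<⇒≤ 1+N<n)
    step : Position k M → + Z (suc N) M ≡ imageSum n k (+ M) (suc N)
    step (at-filter k₀ p 2+p≡)      = agrees-filter k₀ p 2+p≡
    step (at-right-edge lk≤M 2+M≡) = agrees-right-edge k M lk≤M 2+M≡
    step (inside lk≤M 2+M<)        = agrees-inside k M lk≤M 2+M<

  zU≡imageSum : ∀ N → Agrees N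
  zU≡imageSum zero    = agrees-0
  zU≡imageSum (suc N) = agrees-suc N (zU≡imageSum N)

  module Truncation (k M N : ℕ) (lk≤M+1 : l * k ≤ M + 1) (M+2≤ : M + 2 ≤ l * suc k) where

    instance
      2l-nonZero : ℕ.NonZero (2 * l)
      2l-nonZero = ℕ.>-nonZero (ℕP.≤-trans (s≤s z≤n) (ℕP.≤-trans l≥2 (ℕP.m≤m+n l (l + 0))))

    u₁ u₂ n : ℕ
    u₁ = divℕ (N + 1 + l ∸ l * k) (2 * l)
    u₂ = divℕ (N + 1 ∸ l * k) (2 * l)
    n  = suc (u₂ + (u₁ + N))

    N<n : N < n
    N<n = s≤s (ℕP.≤-trans (ℕP.m≤n+m N u₁) (ℕP.m≤n+m (u₁ + N) u₂))

    beyond-floor : ∀ a j → a < 2 * l * suc (divℕ a (2 * l) + j)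
    beyond-floor a j = ℕP.<-≤-trans (subst (λ q → a < 2 * l * suc q) (sym (divℕ-/ a (2 * l))) (m<n*[1+m/n] a (2 * l)))
                                    (ℕP.*-monoʳ-≤ (2 * l) (s≤s (ℕP.m≤m+n _ j)))
      where
      divℕ-/ : ∀ a d .{{_ : ℕ.NonZero d}} → divℕ a d ≡ a ℕ./ d
      divℕ-/ a (suc d) = refl

    right-tail : ∀ j → N < M + 2 * l * suc (u₂ + j)
    right-tail j = ℕP.≤-pred (begin-strict
      suc N                           ≡⟨ ℕP.+-comm 1 N ⟩
      N + 1                           ≤⟨ m≤m∸n+n (N + 1) (l * k) ⟩
      (N + 1 ∸ l * k) + l * k       ≤⟨ ℕP.+-monoʳ-≤ _ lk≤M+1 ⟩
      (N + 1 ∸ l * k) + (M + 1)     <⟨ ℕP.+-monoˡ-< (M + 1) (beyond-floor (N + 1 ∸ l * k) j) ⟩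
      X + (M + 1)                     ≡⟨ shuffle X M ⟩
      suc (M + X)                     ∎)
      where
      open ℕP.≤-Reasoning
      X : ℕ
      X = 2 * l * suc (u₂ + j)
      shuffle : ∀ X M → X + (M + 1) ≡ suc (M + X)
      shuffle = ℕSolver.solve-∀

    left-tail : ∀ j → M + N + 2 < 2 * l * (k + 1 + (u₁ + j))
    left-tail j = begin-strict
      M + N + 2                       <⟨ ℕP.n<1+n _ ⟩
      suc (M + N + 2)                 ≡⟨ shuffle₁ M N ⟩
      (M + 2) + (N + 1)               ≤⟨ ℕP.+-monoˡ-≤ (N + 1) (ℕP.≤-trans M+2≤ (ℕP.≤-reflexive (ℕP.*-suc l k))) ⟩
      (l + l * k) + (N + 1)           ≡⟨ shuffle₂ l (l * k) N ⟩
      (N + 1 + l) + l * k             ≤⟨ ℕP.+-monoˡ-≤ (l * k) (m≤m∸n+n (N + 1 + l) (l * k)) ⟩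
      (a + l * k) + l * k             <⟨ ℕP.+-monoˡ-< (l * k) (ℕP.+-monoˡ-< (l * k) (beyond-floor a j)) ⟩
      (X + l * k) + l * k             ≡⟨ shuffle₃ l k (u₁ + j) ⟩
      2 * l * (k + 1 + (u₁ + j))      ∎
      where
      open ℕP.≤-Reasoning
      a X : ℕ
      a = N + 1 + l ∸ l * k
      X = 2 * l * suc (u₁ + j)
      shuffle₁ : ∀ M N → suc (M + N + 2) ≡ (M + 2) + (N + 1)
      shuffle₁ = ℕSolver.solve-∀
      shuffle₂ : ∀ l lk N → (l + lk) + (N + 1) ≡ (N + 1 + l) + lk
      shuffle₂ = ℕSolver.solve-∀
      shuffle₃ : ∀ l k w → (2 * l * suc w + l * k) + l * k ≡ 2 * l * (k + 1 + w)
      shuffle₃ = ℕSolver.solve-∀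

    f₁ f₂ : ℕ → ℤ
    f₁ j = F N (+ M ℤ.- + (2 * l * k) ℤ.- + (2 * j * l))
    f₂ j = F N (+ M ℤ.+ + (2 * j * l))

    2l*[1+j] : ∀ j → 2l ℤ.* + suc j ≡ + (2 * suc j * l)
    2l*[1+j] j = trans (2l*-pos (suc j)) (cong +_ (swap j l))
      where
      swap : ∀ j l → 2 * l * suc j ≡ 2 * suc j * l
      swap = ℕSolver.solve-∀

    right-images : ℤΣ.sum n (λ i → F N (+ M ℤ.+ 2l ℤ.* + i)) ≡ F N (+ M) ℤ.+ sumFrom1 u₂ f₂
    right-images = cong₂ ℤ._+_ (cong (F N) (origin (+ M) 2l)) (begin
      ℤΣ.sum (u₂ + (u₁ + N)) g  ≡⟨ ℤΣ.sum-truncate u₂ (u₁ + N) g (λ j → F-right-image-vanishes N M (suc (u₂ + j)) (right-tail j)) ⟩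
      ℤΣ.sum u₂ g               ≡⟨ ℤΣ.sum-cong u₂ (λ j → cong (λ z → F N (+ M ℤ.+ z)) (2l*[1+j] j)) ⟩
      ℤΣ.sum u₂ (λ j → f₂ (suc j)) ≡⟨ sym (sumFrom1-sum u₂ f₂) ⟩
      sumFrom1 u₂ f₂ ∎)
      where
      open ≡-Reasoning
      g : ℕ → ℤ
      g i = F N (+ M ℤ.+ 2l ℤ.* + suc i)
      origin : ∀ m x → m ℤ.+ x ℤ.* + 0 ≡ m
      origin = solve-∀

    left-images : ℤΣ.sum n (λ i → F N (+ M ℤ.- 2l ℤ.* (+ k ℤ.+ + 1 ℤ.+ + i))) ≡ sumFrom1 u₁ f₁
    left-images = begin
      ℤΣ.sum n h
        ≡⟨ cong (λ z → ℤΣ.sum z h) (split u₁ u₂ N) ⟩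
      ℤΣ.sum (u₁ + suc (u₂ + N)) h
        ≡⟨ ℤΣ.sum-truncate u₁ (suc (u₂ + N)) h (λ j → F-left-image-vanishes N M (k + 1 + (u₁ + j)) (left-tail j)) ⟩
      ℤΣ.sum u₁ h
        ≡⟨ ℤΣ.sum-cong u₁ (λ j → cong (F N) (trans (ring (+ M) (+ l) (+ k) (+ j))
                                                    (cong₂ (λ x y → + M ℤ.- x ℤ.- y) (2l*-pos k) (2l*[1+j] j)))) ⟩
      ℤΣ.sum u₁ (λ j → f₁ (suc j))
        ≡⟨ sym (sumFrom1-sum u₁ f₁) ⟩
      sumFrom1 u₁ f₁               ∎
      where
      open ≡-Reasoning
      h : ℕ → ℤ
      h i = F N (+ M ℤ.- 2l ℤ.* (+ k ℤ.+ + 1 ℤ.+ + i))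
      split : ∀ u₁ u₂ N → suc (u₂ + (u₁ + N)) ≡ u₁ + suc (u₂ + N)
      split = ℕSolver.solve-∀
      ring : ∀ m l k j → m ℤ.- (+ 2 ℤ.* l) ℤ.* (k ℤ.+ + 1 ℤ.+ j) ≡ m ℤ.- (+ 2 ℤ.* l) ℤ.* k ℤ.- (+ 2 ℤ.* l) ℤ.* (+ 1 ℤ.+ j)
      ring = solve-∀

    imageSum-truncate : imageSum n k (+ M) N ≡ (F N (+ M) ℤ.+ sumFrom1 u₁ f₁) ℤ.+ sumFrom1 u₂ f₂
    imageSum-truncate = trans (cong₂ ℤ._+_ right-images left-images) (swap (F N (+ M)) (sumFrom1 u₂ f₂) (sumFrom1 u₁ f₁))
      where
      swap : ∀ a b c → (a ℤ.+ b) ℤ.+ c ≡ (a ℤ.+ c) ℤ.+ b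
      swap = solve-∀

open import Data.Nat using (_+_; _*_; _∸_)

theorem6p2 : ∀ (l : ℕ) → 2 ≤ l → ∀ (k M N : ℕ) → 2 ∣ (M + N) →
    l * k ≤ M + 1 → M + 2 ≤ l * suc k →
    + ZU l M N ≡
      (F N (+ M)
        ℤ.+ sumFrom1 (divℕ (N + 1 + l ∸ l * k) (2 * l))
              (λ j → F N (+ M ℤ.- + (2 * l * k) ℤ.- + (2 * j * l))))
        ℤ.+ sumFrom1 (divℕ (N + 1 ∸ l * k) (2 * l))
              (λ j → F N (+ M ℤ.+ + (2 * j * l)))
theorem6p2 l l≥2 k M N _ lk≤M+1 M+2≤ =
  trans (zU≡imageSum N n k M lk≤1+M 1+M<l[1+k] N<n) imageSum-truncate
  where
  open Agreement l l≥2
  open Truncation k M N lk≤M+1 M+2≤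
  lk≤1+M : l * k ≤ suc M
  lk≤1+M = subst (l * k ≤_) (ℕP.+-comm M 1) lk≤M+1
  1+M<l[1+k] : suc M < l * suc k
  1+M<l[1+k] = subst (_≤ l * suc k) (ℕP.+-comm M 2) M+2≤
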